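{- Let $\Gamma=(X,\sim)$ be a connected graph such that for every vertex $x$ there are a positive integer $q_x$ and a finite Lie incidence geometry $\Delta(x)$, in which every line has exactly $q_x+1$ points and which is either a parapolar space of symplectic rank at least $3$ whose point graph has diameter $2$ or a polar space of rank at least $2$, such that the local graph $\Gamma(x)$ is isomorphic to the $q_x$-clique extension of the point graph of $\Delta(x)$. Then $q_x=q_y$ for all vertices $x,y\in X$.
   Context: $\Gamma(x)$ is the subgraph induced on the neighbours of $x$. The $q$-clique extension $q\Gamma_0$ of a graph $\Gamma_0=(Y,\sim)$ has vertices $t_i(y)$, $i\in\{1,\ldots,q\}$, $y\in Y$, with $t_i(y)\sim t_j(z)$ iff either $y=z$ and $i\neq j$, or $y\sim z$. A Lie incidence geometry is the point-line geometry whose points are the vertices of a fixed type $i$ of a spherical building and whose typical line is the set of type-$i$ vertices completing a fixed $i$-panel to a chamber; its point graph joins distinct collinear points. A polar space of rank $r$ is a point-line geometry in which every point is collinear with exactly one or all points of any line, no point is collinear with all points, and maximal singular subspaces are projective spaces of dimension $r-1$. A parapolar space of symplectic rank at least $r$ ($r\geq 3$) is a connected gamma space (each point collinear with none, one or all points of each line) such that for distinct noncollinear points $x,y$, $x^\perp\cap y^\perp$ (points collinear with both, with the lines contained in it) is empty, a point, or a polar space of rank at least $r-1$, and for each line $L$, $L^\perp$ contains two noncollinear points. -}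

module Defs where

open import Level using (0ℓ)
open import Data.Nat using (ℕ; zero; suc; _≤_; _<_)
open import Data.Fin using (Fin)
open import Data.Product using (Σ; Σ-syntax; _×_; _,_; proj₁)
open import Data.Sum using (_⊎_)
open import Data.Unit using (⊤)
open import Data.List using (List; []; _∷_; length)
open import Data.List.Relation.Unary.All using (All)
open import Relation.Nullary using (¬_)
open import Relation.Binary.PropositionalEquality using (_≡_; _≢_)
open import Function.Bundles using (_↔_; Inverse)
open import Algebra.Bundles using (Group)

_⇔′_ : Set → Set → Set
A ⇔′ B = (A → B) × (B → A)

record RawGraph : Set₁ where
  field
    V   : Set
    adj : V → V → Set

record Graph : Set₁ where
  field
    V        : Set
    _~_      : V → V → Set
    ~-prop   : ∀ {x y} (p q : x ~ y) → p ≡ q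
    ~-sym    : ∀ {x y} → x ~ y → y ~ x
    ~-irrefl : ∀ {x} → ¬ (x ~ x)

module _ (Γ : Graph) where
  open Graph Γ

  data Reach : V → V → Set where
    here : ∀ {x} → Reach x x
    step : ∀ {x y z} → x ~ y → Reach y z → Reach x z

  Connected : Set
  Connected = ∀ x y → Reach x y

  LocalGraph : V → RawGraph
  LocalGraph x = record { V = Σ V (x ~_) ; adj = λ a b → proj₁ a ~ proj₁ b }

CliqueExt : ℕ → RawGraph → RawGraph
CliqueExt q G = record
  { V   = Fin q × RawGraph.V G
  ; adj = λ { (i , y) (j , z) → (y ≡ z × i ≢ j) ⊎ RawGraph.adj G y z } }

_≅_ : RawGraph → RawGraph → Set
A ≅ B = Σ[ f ∈ (RawGraph.V A ↔ RawGraph.V B) ]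
          (∀ a b → RawGraph.adj A a b ⇔′ RawGraph.adj B (Inverse.to f a) (Inverse.to f b))

gpow : (G : Group 0ℓ 0ℓ) → Group.Carrier G → ℕ → Group.Carrier G
gpow G g zero    = Group.ε G
gpow G g (suc n) = Group._∙_ G g (gpow G g n)

-- Coxeter systems (W , {s i | i ∈ I}), defined by the presentation
-- < s i | (s i s j)^(m i j) = 1 >  where m i j is the order of s i s j
-- (m i i = 1, m i j ≥ 2 for i ≠ j); the presentation is expressed by
-- its universal property.

wordEval : {I W : Set} → (W → W → W) → W → (I → W) → List I → W
wordEval _·_ e s []       = e
wordEval _·_ e s (i ∷ is) = s i · wordEval _·_ e s is

wpow : {W : Set} → (W → W → W) → W → W → ℕ → W
wpow _·_ e w zero    = e
wpow _·_ e w (suc n) = w · wpow _·_ e w n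

record CoxeterSystem (I : Set) : Set₁ where
  infixl 7 _·_
  field
    W       : Set
    _·_     : W → W → W
    e       : W
    _⁻¹     : W → W
    ·-assoc : ∀ a b c → (a · b) · c ≡ a · (b · c)
    ·-idˡ   : ∀ a → e · a ≡ a
    ·-idʳ   : ∀ a → a · e ≡ a
    ·-invˡ  : ∀ a → (a ⁻¹) · a ≡ e
    ·-invʳ  : ∀ a → a · (a ⁻¹) ≡ e
    s         : I → W
    s-invol   : ∀ i → s i · s i ≡ e
    s-nontriv : ∀ i → s i ≢ e
    s-inj     : ∀ i j → s i ≡ s j → i ≡ j

    generated    : ∀ w → Σ[ is ∈ List I ] wordEval _·_ e s is ≡ w
    presentation : (G : Group 0ℓ 0ℓ) (f : I → Group.Carrier G) →
      (∀ i j n → wpow _·_ e (s i · s j) n ≡ e →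
         Group._≈_ G (gpow G (Group._∙_ G (f i) (f j)) n) (Group.ε G)) →
      Σ[ φ ∈ (W → Group.Carrier G) ]
        ((∀ a b → Group._≈_ G (φ (a · b)) (Group._∙_ G (φ a) (φ b)))
         × (∀ i → Group._≈_ G (φ (s i)) (f i)))

module _ {I : Set} (Cx : CoxeterSystem I) where
  open CoxeterSystem Cx

  eval : List I → W
  eval = wordEval _·_ e s

  HasLength : W → ℕ → Set
  HasLength w m = (Σ[ is ∈ List I ] (length is ≡ m × eval is ≡ w))
                × (∀ is → eval is ≡ w → m ≤ length is)

  InParabolic : (I → Set) → W → Set
  InParabolic J w = Σ[ is ∈ List I ] (All J is × eval is ≡ w)

-- Thick buildings of type (W,S) as W-metric spaces (Abramenko–Brown
-- Def. 5.1), together with their typed vertices: a vertex of type i is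
-- an (S∖{s i})-residue; vx c i is the type-i vertex of chamber c.

record Building {I : Set} (Cx : CoxeterSystem I) : Set₁ where
  open CoxeterSystem Cx
  field
    Ch        : Set
    δ         : Ch → Ch → W
    inhabited : Ch
    WD1 : ∀ c d → (δ c d ≡ e) ⇔′ (c ≡ d)
    WD2 : ∀ c d c′ i → δ c′ c ≡ s i →
            (δ c′ d ≡ s i · δ c d ⊎ δ c′ d ≡ δ c d)
            × ((∀ m → HasLength Cx (δ c d) m → HasLength Cx (s i · δ c d) (suc m))
               → δ c′ d ≡ s i · δ c d)
    WD3 : ∀ c d i → Σ[ c′ ∈ Ch ] (δ c′ c ≡ s i × δ c′ d ≡ s i · δ c d)
    -- thickness: every panel lies in at least three chambers
    thick : ∀ c i → Σ[ d₁ ∈ Ch ] Σ[ d₂ ∈ Ch ]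
              (δ c d₁ ≡ s i × δ c d₂ ≡ s i × d₁ ≢ d₂)
    Vtx    : I → Set
    vx     : Ch → (i : I) → Vtx i
    vx-surj : ∀ i (v : Vtx i) → Σ[ c ∈ Ch ] vx c i ≡ v
    vx-res  : ∀ c d i → (vx c i ≡ vx d i) ⇔′ InParabolic Cx (λ j → j ≢ i) (δ c d)

record PLGeom : Set₁ where
  field
    Pt   : Set
    Ln   : Set
    _∈L_ : Pt → Ln → Set

-- Lines are indexed by chambers c: the line of c
-- consists of the type-i vertices of the chambers of the i-panel of c.
record LieIncidenceGeometry : Set₁ where
  field
    n         : ℕ
    cox       : CoxeterSystem (Fin n)
    spherical : Σ[ m ∈ ℕ ] (CoxeterSystem.W cox ↔ Fin m)
    bld       : Building cox
    type      : Fin n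

  open CoxeterSystem cox
  open Building bld

  geom : PLGeom
  geom = record
    { Pt   = Vtx type
    ; Ln   = Ch
    ; _∈L_ = λ p c → Σ[ d ∈ Ch ] ((δ c d ≡ e ⊎ δ c d ≡ s type) × vx d type ≡ p) }

module Geometry (G : PLGeom) where
  open PLGeom G

  Pred : Set₁
  Pred = Pt → Set

  Adj : Pt → Pt → Set
  Adj p q = p ≢ q × Σ[ L ∈ Ln ] (p ∈L L × q ∈L L)

  pointGraph : RawGraph
  pointGraph = record { V = Pt ; adj = Adj }

  FinitePts : Set
  FinitePts = Σ[ m ∈ ℕ ] (Pt ↔ Fin m)

  LinesHave : ℕ → Set
  LinesHave k = ∀ L → Σ[ f ∈ (Fin k → Pt) ]
    ((∀ a b → f a ≡ f b → a ≡ b) × (∀ a → f a ∈L L) × (∀ p → p ∈L L → Σ[ a ∈ Fin k ] f a ≡ p))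

  _⊆_ : Pred → Pred → Set
  S ⊆ T = ∀ p → S p → T p

  -- notions relative to the subgeometry induced on a point set T
  -- (points of T, lines contained in T)
  module On (T : Pred) where
    LnIn : Ln → Set
    LnIn L = ∀ p → p ∈L L → T p

    Coll : Pt → Pt → Set
    Coll p q = p ≡ q ⊎ Σ[ L ∈ Ln ] (LnIn L × p ∈L L × q ∈L L)

    OneOrAll : Pt → Ln → Set
    OneOrAll p L =
      (Σ[ y ∈ Pt ] (y ∈L L × Coll p y × (∀ z → z ∈L L → Coll p z → z ≡ y)))
      ⊎ (∀ z → z ∈L L → Coll p z)

    IsSubspace : Pred → Set
    IsSubspace S = S ⊆ T × (∀ L a b → LnIn L → a ≢ b → a ∈L L → b ∈L L →
                              S a → S b → ∀ z → z ∈L L → S z)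

    IsSingular : Pred → Set
    IsSingular S = ∀ a b → S a → S b → Coll a b

    IsMaxSingular : Pred → Set₁
    IsMaxSingular S = IsSubspace S × IsSingular S
      × (∀ S′ → IsSubspace S′ → IsSingular S′ → S ⊆ S′ → S′ ⊆ S)

    HasChain : Pred → ℕ → Set₁
    HasChain S m = Σ[ c ∈ (ℕ → Pred) ]
      ((∀ p → ¬ c 0 p) × (c m ⊆ S × S ⊆ c m) × (∀ k → k ≤ m → IsSubspace (c k))
       × (∀ k → k < m → c k ⊆ c (suc k) × Σ[ p ∈ Pt ] (c (suc k) p × ¬ c k p)))

    -- S (a subspace) is a projective space of dimension d, i.e. the
    -- longest chain of subspaces has d+1 = r strict inclusions
    IsProjectiveSpace : Pred → Set
    IsProjectiveSpace S =
      (∀ a b → S a → S b → a ≢ b → Σ[ L ∈ Ln ] (LnIn L × a ∈L L × b ∈L L))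
      × (∀ L M a b → S a → S b → LnIn L → LnIn M → a ≢ b → a ∈L L → b ∈L L → a ∈L M → b ∈L M →
           ∀ z → (z ∈L L → z ∈L M) × (z ∈L M → z ∈L L))
      × (∀ L a b → LnIn L → S a → S b → a ≢ b → a ∈L L → b ∈L L →
           Σ[ x ∈ Pt ] Σ[ y ∈ Pt ] Σ[ z ∈ Pt ]
             (x ∈L L × y ∈L L × z ∈L L × x ≢ y × y ≢ z × x ≢ z))
      × (∀ a b c d L₁ L₂ L₃ L₄ → S a → S b → S c → S d →
           LnIn L₁ → LnIn L₂ → LnIn L₃ → LnIn L₄ →
           a ≢ b → c ≢ d → a ≢ c → b ≢ d →
           a ∈L L₁ → b ∈L L₁ → c ∈L L₂ → d ∈L L₂ → a ∈L L₃ → c ∈L L₃ →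
           b ∈L L₄ → d ∈L L₄ →
           Σ[ p ∈ Pt ] (p ∈L L₁ × p ∈L L₂) → Σ[ p ∈ Pt ] (p ∈L L₃ × p ∈L L₄))

    ProjectiveOfRank : Pred → ℕ → Set₁
    ProjectiveOfRank S r = IsProjectiveSpace S × HasChain S r × ¬ HasChain S (suc r)

    -- polar space of rank r (maximal singular subspaces are projective
    -- spaces of dimension r-1)
    IsPolarOfRank : ℕ → Set₁
    IsPolarOfRank r =
      (∀ p L → T p → LnIn L → OneOrAll p L)
      × (∀ p → T p → ¬ (∀ z → T z → Coll p z))
      × (∀ S → IsMaxSingular S → ProjectiveOfRank S r)

    IsPolarOfRankAtLeast : ℕ → Set₁
    IsPolarOfRankAtLeast r = Σ[ r′ ∈ ℕ ] (r ≤ r′ × IsPolarOfRank r′)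

  open On (λ _ → ⊤) public

  IsPolarSpaceOfRankAtLeast : ℕ → Set₁
  IsPolarSpaceOfRankAtLeast = IsPolarOfRankAtLeast

  data PReach : Pt → Pt → Set where
    here : ∀ {x} → PReach x x
    step : ∀ {x y z} → Adj x y → PReach y z → PReach x z

  Perp : Pt → Pred
  Perp x = Coll x

  IsParapolarSympRank≥3 : Set₁
  IsParapolarSympRank≥3 =
    (∀ x y → PReach x y)
    × (∀ p L → (∀ z → z ∈L L → ¬ Coll p z) ⊎ OneOrAll p L)
    × (∀ x y → x ≢ y → ¬ Coll x y →
         let T = λ p → Perp x p × Perp y p in
         (∀ p → ¬ T p)
         ⊎ (Σ[ p ∈ Pt ] (T p × ∀ z → T z → z ≡ p))
         ⊎ On.IsPolarOfRankAtLeast T 2)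
    × (∀ L → Σ[ a ∈ Pt ] Σ[ b ∈ Pt ]
         ((∀ z → z ∈L L → Coll a z) × (∀ z → z ∈L L → Coll b z) × ¬ Coll a b))

  Diameter2 : Set
  Diameter2 = (∀ p q → p ≡ q ⊎ Adj p q ⊎ Σ[ z ∈ Pt ] (Adj p z × Adj z q))
            × Σ[ p ∈ Pt ] Σ[ q ∈ Pt ] (p ≢ q × ¬ Adj p q)

LocalHypothesis : (Γ : Graph) → Graph.V Γ → ℕ → LieIncidenceGeometry → Set₁
LocalHypothesis Γ x q Δ =
  1 ≤ q × FinitePts × LinesHave (suc q)
  × ((IsParapolarSympRank≥3 × Diameter2) ⊎ IsPolarSpaceOfRankAtLeast 2)
  × (LocalGraph Γ x ≅ CliqueExt q pointGraph)
  where open Geometry (LieIncidenceGeometry.geom Δ)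

{-# OPTIONS --safe #-}

-- Let x ~ y, and let y and the vertices z_j (j ≠ i) form the clique of Γ(x)
-- over a point p of Δ(x).  Every neighbour of y in Γ(x) other than z_j is a
-- neighbour of z_j, so in Γ(y) the closed neighbourhood of x lies in that of
-- z_j.  In a clique extension this forces x and z_j to lie over the same
-- point of Δ(y), because in Δ(y) every point p has, for each neighbour p',
-- a neighbour that is neither equal nor collinear to p'.  In a polar space
-- this follows from nondegeneracy; in a parapolar space it follows inside
-- the polar space a^⊥ ∩ b^⊥ for noncollinear a, b ∈ (pp')^⊥.  Hence x and
-- the z_j are q_x distinct vertices of one clique of Γ(y), so q_x ≤ q_y, and
-- q is constant by symmetry and connectedness.

module Submission where

open import Defs
open import Data.Nat using (ℕ; zero; suc; _≤_; z≤n)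
open import Data.Nat.Properties using (≤-antisym)
open import Data.Fin using (Fin; zero; suc; punchIn)
open import Data.Fin.Properties using (injective⇒≤; punchIn-injective; punchInᵢ≢i)
open import Data.Product using (Σ; Σ-syntax; _×_; _,_; proj₁; proj₂)
open import Data.Sum using (_⊎_; inj₁; inj₂)
open import Data.Unit using (⊤)
open import Data.Empty using (⊥; ⊥-elim)
open import Function using (_∘_)
open import Function.Bundles using (_↔_; Inverse; Injection)
open import Function.Definitions using (Injective)
open import Function.Properties.Inverse using (↔-sym; ↔⇒↣)
open import Relation.Nullary using (¬_)
open import Relation.Nullary.Negation using (¬¬-map)
open import Relation.Binary.PropositionalEquality

private variable
  A B : Set
  m k : ℕ

¬¬-∀-Fin : ∀ n {P : Fin n → Set} → (∀ i → ¬ ¬ P i) → ¬ ¬ (∀ i → P i)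
¬¬-∀-Fin zero    h k = k λ ()
¬¬-∀-Fin (suc n) h k =
  h zero λ p₀ → ¬¬-∀-Fin n (h ∘ suc) λ ps → k λ { zero → p₀ ; (suc i) → ps i }

¬¬-∀-finite : A ↔ Fin m → {P : A → Set} → (∀ a → ¬ ¬ P a) → ¬ ¬ (∀ a → P a)
¬¬-∀-finite {m = m} f {P} h k =
  ¬¬-∀-Fin m (h ∘ from) λ ps → k λ a → subst P (strictlyInverseʳ a) (ps (to a))
  where open Inverse f

↔-injective : (f : A ↔ B) → Injective _≡_ _≡_ (Inverse.to f)
↔-injective f = Injection.injective (↔⇒↣ f)

injective-into-fibre⇒≤ : {b : B} (w : Fin m → Fin k × B) → Injective _≡_ _≡_ w →
                         (∀ j → proj₂ (w j) ≡ b) → m ≤ k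
injective-into-fibre⇒≤ w w-inj w-fibre = injective⇒≤ λ {i} {j} eq →
  w-inj (cong₂ _,_ eq (trans (w-fibre i) (sym (w-fibre j))))

module Collinearity (G : PLGeom) (T : PLGeom.Pt G → Set) where
  open PLGeom G
  open Geometry.On G T

  private variable
    a b c p : Pt
    L : Ln

  Coll-sym : Coll a b → Coll b a
  Coll-sym (inj₁ a≡b)               = inj₁ (sym a≡b)
  Coll-sym (inj₂ (L , L⊆T , aL , bL)) = inj₂ (L , L⊆T , bL , aL)

  Coll-on-line : LnIn L → a ∈L L → b ∈L L → Coll a b
  Coll-on-line L⊆T aL bL = inj₂ (_ , L⊆T , aL , bL)

  exactly-one : OneOrAll p L → c ∈L L → ¬ Coll p c →
                Σ[ y ∈ Pt ] (y ∈L L × Coll p y × (∀ z → z ∈L L → Coll p z → z ≡ y))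
  exactly-one (inj₁ one) _  _     = one
  exactly-one (inj₂ all) cL ¬cpc = ⊥-elim (¬cpc (all _ cL))

  two-collinear⇒all : OneOrAll p L → a ≢ b → a ∈L L → b ∈L L → Coll p a → Coll p b →
                      ∀ z → z ∈L L → Coll p z
  two-collinear⇒all (inj₂ all)                a≢b _  _  _   _   = all
  two-collinear⇒all (inj₁ (_ , _ , _ , uniq)) a≢b aL bL cpa cpb =
    ⊥-elim (a≢b (trans (uniq _ aL cpa) (sym (uniq _ bL cpb))))

module NondegeneratePolar
  (G : PLGeom) (T : PLGeom.Pt G → Set)
  (one-or-all : ∀ p L → T p → Geometry.On.LnIn G T L → Geometry.On.OneOrAll G T p L)
  (noncollinear : ∀ p → T p →
     ¬ ¬ (Σ[ z ∈ PLGeom.Pt G ] (T z × ¬ Geometry.On.Coll G T p z)))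
  where
  open PLGeom G
  open Geometry.On G T
  open Collinearity G T

  ¬perp⊆perp : ∀ {p y w M} → T p → LnIn M → y ∈L M → w ∈L M → Coll p y → ¬ Coll p w →
               ¬ (∀ u → T u → Coll p u → ¬ ¬ Coll y u)
  ¬perp⊆perp {p} {y} {w} {M} tp M⊆T yM wM cpy ¬cpw p⊥⊆y⊥ =
    noncollinear y (M⊆T y yM) λ (v , tv , ¬cyv) → refute v tv ¬cyv
    where
    refute : ∀ v → T v → ¬ Coll y v → ⊥
    refute v tv ¬cyv with exactly-one (one-or-all v M tv M⊆T) yM (¬cyv ∘ Coll-sym)
    ... | m , mM , cvm , _ = join cvm
      where
      -- M meets p^⊥ only in y, and m ≠ y
      ¬cpm : ¬ Coll p m
      ¬cpm cpm with exactly-one (one-or-all p M tp M⊆T) wM ¬cpw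
      ... | _ , _ , _ , uniq =
        ¬cyv (Coll-sym (subst (Coll v) (trans (uniq m mM cpm) (sym (uniq y yM cpy))) cvm))

      join : Coll v m → ⊥
      join (inj₁ v≡m) = ¬cyv (subst (Coll y) (sym v≡m) (Coll-on-line M⊆T yM mM))
      join (inj₂ (K , K⊆T , vK , mK))
        with exactly-one (one-or-all p K tp K⊆T) mK ¬cpm
      ... | u , uK , cpu , _ = p⊥⊆y⊥ u (K⊆T u uK) cpu λ cyu →
        let _ , _ , _ , uniq = exactly-one (one-or-all y K (M⊆T y yM) K⊆T) vK ¬cyv
        in ¬cpm (subst (Coll p) (trans (uniq u uK cyu) (sym (uniq m mK (Coll-on-line M⊆T yM mM)))) cpu)

  private-neighbour : ∀ {p p' L} → LnIn L → p ∈L L → p' ∈L L → p ≢ p' →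
                      ¬ ¬ (Σ[ s ∈ Pt ] (T s × Coll p s × ¬ Coll p' s))
  private-neighbour {p} {p'} {L} L⊆T pL p'L p≢p' none =
    noncollinear p' (L⊆T p' p'L) λ (w , tw , ¬cp'w) → refute w tw ¬cp'w
    where
    p⊥⊆p'⊥ : ∀ s → T s → Coll p s → ¬ ¬ Coll p' s
    p⊥⊆p'⊥ s ts cps ¬cp's = none (s , ts , cps , ¬cp's)

    p⊥⊆L⊥ : ∀ u → T u → Coll p u → ∀ y → y ∈L L → ¬ ¬ Coll y u
    p⊥⊆L⊥ u tu cpu y yL = ¬¬-map (λ cp'u → Coll-sym
      (two-collinear⇒all (one-or-all u L tu L⊆T) p≢p' pL p'L (Coll-sym cpu) (Coll-sym cp'u) y yL))
      (p⊥⊆p'⊥ u tu cpu)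

    refute : ∀ w → T w → ¬ Coll p' w → ⊥
    refute w tw ¬cp'w with exactly-one (one-or-all w L tw L⊆T) pL (¬cpw ∘ Coll-sym)
      where
      ¬cpw : ¬ Coll p w
      ¬cpw cpw = p⊥⊆p'⊥ w tw cpw ¬cp'w
    ... | y , yL , inj₁ w≡y , _ =
      p⊥⊆p'⊥ w tw (subst (Coll p) (sym w≡y) (Coll-on-line L⊆T pL yL)) ¬cp'w
    ... | y , yL , inj₂ (M , M⊆T , wM , yM) , _ =
      ¬perp⊆perp (L⊆T p pL) M⊆T yM wM (Coll-on-line L⊆T pL yL)
        (λ cpw → p⊥⊆p'⊥ w tw cpw ¬cp'w) (λ u tu cpu → p⊥⊆L⊥ u tu cpu y yL)

module PrivateNeighbours (G : PLGeom) where
  open PLGeom G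
  open Geometry G

  private variable
    p p' : Pt
    L : Ln

  PrivateNeighbour : Pt → Pt → Set
  PrivateNeighbour p p' = Σ[ s ∈ Pt ] (Adj p s × s ≢ p' × ¬ Adj p' s)

  HasPrivateNeighbours : Set
  HasPrivateNeighbours = ∀ p p' → Adj p p' → ¬ ¬ PrivateNeighbour p p'

  ContainsJoiningLines : Pred → Set
  ContainsJoiningLines T = ∀ u v → T u → T v → Adj u v → On.Coll T u v

  finite⇒noncollinear : FinitePts → (T : Pred) → ∀ {p} →
                        ¬ (∀ z → T z → On.Coll T p z) →
                        ¬ ¬ (Σ[ z ∈ Pt ] (T z × ¬ On.Coll T p z))
  finite⇒noncollinear (_ , f) T nondegenerate none = ¬¬-∀-finite f
    (λ z ¬Tz⇒Coll → ¬Tz⇒Coll λ tz → ⊥-elim (none (z , tz , λ c → ¬Tz⇒Coll λ _ → c)))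
    nondegenerate

  private-neighbour-in : (T : Pred) → ContainsJoiningLines T →
    On.LnIn T L → p ∈L L → p' ∈L L →
    Σ[ s ∈ Pt ] (T s × On.Coll T p s × ¬ On.Coll T p' s) → PrivateNeighbour p p'
  private-neighbour-in {p = p} T lines-in-T L⊆T pL p'L (s , ts , cps , ¬cp's) =
    s , adjacent cps , (λ s≡p' → ¬cp's (inj₁ (sym s≡p'))) , ¬cp's ∘ lines-in-T _ s (L⊆T _ p'L) ts
    where
    open Collinearity G T
    p≢s : p ≢ s
    p≢s p≡s = ¬cp's (subst (On.Coll T _) p≡s (Coll-on-line L⊆T p'L pL))

    adjacent : On.Coll T p s → Adj p s
    adjacent (inj₁ p≡s)               = ⊥-elim (p≢s p≡s)
    adjacent (inj₂ (M , _ , pM , sM)) = p≢s , M , pM , sM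

  polar⇒private-neighbours : FinitePts → (T : Pred) →
    On.IsPolarOfRankAtLeast T 2 → ContainsJoiningLines T →
    On.LnIn T L → p ∈L L → p' ∈L L → p ≢ p' → ¬ ¬ PrivateNeighbour p p'
  polar⇒private-neighbours fin T (_ , _ , one-or-all , nondegenerate , _) lines-in-T L⊆T pL p'L p≢p' =
    ¬¬-map (private-neighbour-in T lines-in-T L⊆T pL p'L)
      (private-neighbour L⊆T pL p'L p≢p')
    where open NondegeneratePolar G T one-or-all
                (λ p tp → finite⇒noncollinear fin T (nondegenerate p tp))

  parapolar⇒private-neighbours : FinitePts → IsParapolarSympRank≥3 → HasPrivateNeighbours
  parapolar⇒private-neighbours fin (_ , gamma , meet , line-perp) p p' (p≢p' , L , pL , p'L)
    with line-perp L
  ... | a , b , aL⊥ , bL⊥ , ¬cab with meet a b (λ a≡b → ¬cab (inj₁ a≡b)) ¬cab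
  ... | inj₁ empty = ⊥-elim (empty p (aL⊥ p pL , bL⊥ p pL))
  ... | inj₂ (inj₁ (_ , _ , single)) =
    ⊥-elim (p≢p' (trans (single p (aL⊥ p pL , bL⊥ p pL)) (sym (single p' (aL⊥ p' p'L , bL⊥ p' p'L)))))
  ... | inj₂ (inj₂ polar) =
    polar⇒private-neighbours fin T polar lines-in-T (λ z zL → aL⊥ z zL , bL⊥ z zL) pL p'L p≢p'
    where
    open Collinearity G (λ _ → ⊤)
    T : Pred
    T z = Perp a z × Perp b z

    perp-contains-line : ∀ {x u v M} → Perp x u → Perp x v → u ≢ v → u ∈L M → v ∈L M →
                         ∀ z → z ∈L M → Perp x z
    perp-contains-line {x} {u} {M = M} cxu cxv u≢v uM vM with gamma x M
    ... | inj₁ none = ⊥-elim (none u uM cxu)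
    ... | inj₂ one-or-all = two-collinear⇒all one-or-all u≢v uM vM cxu cxv

    lines-in-T : ContainsJoiningLines T
    lines-in-T u v (cau , cbu) (cav , cbv) (u≢v , M , uM , vM) = inj₂ (M , M⊆T , uM , vM)
      where
      M⊆T : On.LnIn T M
      M⊆T z zM = perp-contains-line cau cav u≢v uM vM z zM , perp-contains-line cbu cbv u≢v uM vM z zM

  private-neighbours : FinitePts →
    (IsParapolarSympRank≥3 × Diameter2) ⊎ IsPolarSpaceOfRankAtLeast 2 → HasPrivateNeighbours
  private-neighbours fin (inj₁ (parapolar , _)) = parapolar⇒private-neighbours fin parapolar
  private-neighbours fin (inj₂ polar) p p' (p≢p' , L , pL , p'L) =
    polar⇒private-neighbours fin (λ _ → ⊤) polar
      (λ _ _ _ _ (_ , M , uM , vM) → inj₂ (M , _ , uM , vM)) _ pL p'L p≢p'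

Dominates : (H : RawGraph) → RawGraph.V H → RawGraph.V H → Set
Dominates H b a = adj a b × (∀ c → adj a c → c ≢ b → adj b c)
  where open RawGraph H

module _ (H K : RawGraph) (φ : H ≅ K) where
  open Inverse (proj₁ φ)

  private
    adj⇒ : ∀ a b → RawGraph.adj H a b → RawGraph.adj K (to a) (to b)
    adj⇒ a b = proj₁ (proj₂ φ a b)
    adj⇐ : ∀ a b → RawGraph.adj K (to a) (to b) → RawGraph.adj H a b
    adj⇐ a b = proj₂ (proj₂ φ a b)

  Dominates-preserved : ∀ {a b} → Dominates H b a → Dominates K (to b) (to a)
  Dominates-preserved {a} {b} (ab , dom) = adj⇒ a b ab , λ c ac c≢b →
    subst (RawGraph.adj K (to b)) (strictlyInverseˡ c)
      (adj⇒ b (from c) (dom (from c)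
        (adj⇐ a (from c) (subst (RawGraph.adj K (to a)) (sym (strictlyInverseˡ c)) ac))
        (λ c′≡b → c≢b (trans (sym (strictlyInverseˡ c)) (cong to c′≡b)))))

  Dominates-reflected : ∀ {a b} → Dominates K (to b) (to a) → Dominates H b a
  Dominates-reflected {a} {b} (ab , dom) = adj⇐ a b ab , λ c ac c≢b →
    adj⇐ b c (dom (to c) (adj⇒ a c ac) (c≢b ∘ ↔-injective (proj₁ φ)))

module _ (G : PLGeom) {q : ℕ} where
  open PLGeom G
  open Geometry G
  open PrivateNeighbours G

  CliqueExt-Dominates : ∀ {i j p} → i ≢ j → Dominates (CliqueExt q pointGraph) (j , p) (i , p)
  CliqueExt-Dominates i≢j = inj₁ (refl , i≢j) , λ where
    (k , r) (inj₁ (refl , _)) c≢j → inj₁ (refl , λ j≡k → c≢j (cong (_, r) (sym j≡k)))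
    (k , r) (inj₂ adj)        _   → inj₂ adj

  Dominates-CliqueExt⇒same-point : HasPrivateNeighbours →
    ∀ {a b} → Dominates (CliqueExt q pointGraph) b a → proj₂ a ≡ proj₂ b
  Dominates-CliqueExt⇒same-point _ (inj₁ (p≡p' , _) , _) = p≡p'
  Dominates-CliqueExt⇒same-point private-nbr {i , p} {j , p'} (inj₂ adj , dom) =
    ⊥-elim (private-nbr p p' adj not-private)
    where
    not-private : ¬ PrivateNeighbour p p'
    not-private (s , ps , s≢p' , ¬p's) with dom (i , s) (inj₂ ps) (s≢p' ∘ cong proj₂)
    ... | inj₁ (p'≡s , _) = s≢p' (sym p'≡s)
    ... | inj₂ p's        = ¬p's p's

module _ (Γ : Graph) where
  open Graph Γ

  local-≡ : ∀ {x} {a b : Σ V (x ~_)} → proj₁ a ≡ proj₁ b → a ≡ b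
  local-≡ {a = a , xa} {b = .a , xa′} refl = cong (a ,_) (~-prop xa xa′)

  Dominates-local-swap : ∀ {x y z} (xy : x ~ y) (xz : x ~ z) (yz : y ~ z) →
    Dominates (LocalGraph Γ x) (z , xz) (y , xy) → Dominates (LocalGraph Γ y) (z , yz) (x , ~-sym xy)
  Dominates-local-swap _ xz _ (_ , dom) = xz , λ (w , yw) xw w≢z →
    dom (w , xw) yw λ w≡z → w≢z (local-≡ (cong proj₁ w≡z))

  clique-size-mono : ∀ {x y Gx Gy qx qy} → x ~ y →
    LocalGraph Γ x ≅ CliqueExt qx (Geometry.pointGraph Gx) →
    LocalGraph Γ y ≅ CliqueExt qy (Geometry.pointGraph Gy) →
    PrivateNeighbours.HasPrivateNeighbours Gy →
    qx ≤ qy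
  clique-size-mono {qx = zero} _ _ _ _ = z≤n
  clique-size-mono {x} {y} {Gx} {Gy} {suc n} {qy} x~y φx φy private-nbr =
    injective-into-fibre⇒≤ (toy ∘ member) (member-injective ∘ ↔-injective (proj₁ φy)) member-point
    where
    open Inverse (proj₁ φx) renaming (to to tox; from to fromx; strictlyInverseˡ to tox∘fromx)
    open Inverse (proj₁ φy) using () renaming (to to toy)

    CEx CEy : RawGraph
    CEx = CliqueExt (suc n) (Geometry.pointGraph Gx)
    CEy = CliqueExt qy (Geometry.pointGraph Gy)

    i : Fin (suc n)
    i = proj₁ (tox (y , x~y))
    p : PLGeom.Pt Gx
    p = proj₂ (tox (y , x~y))

    z : Fin (suc n) → Σ V (x ~_)
    z j = fromx (j , p)

    z-dominates-y : ∀ {j} → j ≢ i → Dominates (LocalGraph Γ x) (z j) (y , x~y)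
    z-dominates-y {j} j≢i = Dominates-reflected (LocalGraph Γ x) CEx φx
      (subst (λ c → Dominates CEx c (i , p)) (sym (tox∘fromx (j , p)))
        (CliqueExt-Dominates Gx (j≢i ∘ sym)))

    member : Fin (suc n) → Σ V (y ~_)
    member zero    = x , ~-sym x~y
    member (suc k) = proj₁ (z (punchIn i k)) , proj₁ (z-dominates-y (punchInᵢ≢i i k))

    member-dominates : ∀ k → Dominates (LocalGraph Γ y) (member (suc k)) (member zero)
    member-dominates k = Dominates-local-swap x~y _ _ (z-dominates-y (punchInᵢ≢i i k))

    member-point : ∀ j → proj₂ (toy (member j)) ≡ proj₂ (toy (member zero))
    member-point zero    = refl
    member-point (suc k) = sym (Dominates-CliqueExt⇒same-point Gy private-nbr
      (Dominates-preserved (LocalGraph Γ y) CEy φy (member-dominates k)))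

    x∉z : ∀ j → x ≢ proj₁ (z j)
    x∉z j x≡z = ~-irrefl (subst (x ~_) (sym x≡z) (proj₂ (z j)))

    member-injective : Injective _≡_ _≡_ member
    member-injective {zero}  {zero}  _  = refl
    member-injective {zero}  {suc k} eq = ⊥-elim (x∉z _ (cong proj₁ eq))
    member-injective {suc j} {zero}  eq = ⊥-elim (x∉z _ (sym (cong proj₁ eq)))
    member-injective {suc j} {suc k} eq = cong suc (punchIn-injective i j k
      (cong proj₁ (↔-injective (↔-sym (proj₁ φx)) (local-≡ (cong proj₁ eq)))))

edge-monotone⇒constant : (Γ : Graph) → Connected Γ → (f : Graph.V Γ → ℕ) →
  (∀ {x y} → Graph._~_ Γ x y → f x ≤ f y) → ∀ x y → f x ≡ f y
edge-monotone⇒constant Γ connected f mono x y = along (connected x y)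
  where
  along : ∀ {x y} → Reach Γ x y → f x ≡ f y
  along here           = refl
  along (step x~y r) = trans (≤-antisym (mono x~y) (mono (Graph.~-sym Γ x~y))) (along r)

lemma3p2 : (Γ : Graph) → Connected Γ →
             (q : Graph.V Γ → ℕ) (Δ : Graph.V Γ → LieIncidenceGeometry) →
             (∀ x → LocalHypothesis Γ x (q x) (Δ x)) →
             ∀ x y → q x ≡ q y
lemma3p2 Γ connected q Δ H = edge-monotone⇒constant Γ connected q q-mono
  where
  geom : Graph.V Γ → PLGeom
  geom = LieIncidenceGeometry.geom ∘ Δ

  q-mono : ∀ {x y} → Graph._~_ Γ x y → q x ≤ q y
  q-mono {x} {y} x~y =
    let _ , _     , _ , _     , φx = H x
        _ , fin   , _ , shape , φy = H y
    in clique-size-mono Γ {Gx = geom x} {Gy = geom y} x~y φx φy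
         (PrivateNeighbours.private-neighbours _ fin shape)
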